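{- In the projective limit model of $\mathrm{TC}+\mathrm{REC}$, for all non-expansive $\phi,\psi:\mathbb P\to\mathbb P$ that are guarded operations, $d(\mathrm{fix}(\phi),\mathrm{fix}(\psi))\le\delta(\phi,\psi)$, where $\delta(\phi,\psi)=\sup\{d(\phi(p),\psi(p)):p\in\mathbb P\}$.
   Context: Fix a set $\mathcal F$ of foci, a set $\mathcal M$ of methods and an infinite set $\mathcal S$ of spots. Basic actions are the expressions $f.m$ with $f\in\mathcal F$, $m\in\mathcal M$; there is moreover an internal action $\tau$. A service is a function $H$ from non-empty finite sequences over $\mathcal M$ to $\{\mathsf T,\mathsf F,\mathsf R\}$ such that $H(\alpha)=\mathsf R$ implies $H(\alpha\frown\langle m\rangle)=\mathsf R$; $\partial_m H$ denotes the service $\alpha\mapsto H(\langle m\rangle\frown\alpha)$. A subset $\mathcal M_{md}\subseteq\mathcal M$ of molecular dynamics methods is given, containing for each spot $s$ an undefinedness-test method $\mathrm{undef}(s)$; $N(m)$ is the finite set of spots occurring in $m$, and spots occur only in methods of $\mathcal M_{md}$. A fixed family $\mathrm{MDS}$ of services is given and $H(\langle m\rangle)=\mathsf R$ for all $m\in\mathcal M_{md}$ whenever $H\notin\mathrm{MDS}$. Terms of $\mathrm{TC}$ are built from variables using: constants $\mathsf S$ (termination), $\mathsf D$ (deadlock); for each $a$ which is a basic action or $\tau$, binary postconditional composition $t_1\unlhd a\unrhd t_2$; for each $k\ge 0$, cyclic interleaving $\|(\langle t_1\rangle\frown\cdots\frown\langle t_k\rangle)$; deadlock at termination $\mathrm{S2D}(t)$;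 for each focus $f$ and service $H$, thread-service composition $t/_fH$; for each focus $f$ and spot $s$, restriction $\nu^f_s(t)$. $a\circ t$ abbreviates $t\unlhd a\unrhd t$. $s\in\mathrm{FN}^f(t)$ iff some occurrence of $s$ in a basic action $f.m$ of $t$ is not inside a subterm $\nu^f_s(\cdot)$ (for a sequence of terms, take the union). $t[s'/s]^f$ is capture-avoiding substitution of $s'$ for the free (w.r.t. $f$) occurrences of $s$ in basic actions $f.m$ of $t$. Axioms of $\mathrm{TC}$ ($x,y$ variables, $\alpha$ a sequence of terms, $a$ a basic action, $f,g$ foci, $m$ a method, $s,s'$ spots, $H$ a service, $t$ a term): T1 $x\unlhd\tau\unrhd y=\tau\circ x$; CSI1 $\|(\langle\rangle)=\mathsf S$; CSI2 $\|(\langle\mathsf S\rangle\frown\alpha)=\|(\alpha)$; CSI3 $\|(\langle\mathsf D\rangle\frown\alpha)=\mathrm{S2D}(\|(\alpha))$; CSI4 $\|(\langle\tau\circ x\rangle\frown\alpha)=\tau\circ\|(\alpha\frown\langle x\rangle)$; CSI5 $\|(\langle x\unlhd a\unrhd y\rangle\frown\alpha)=\|(\alpha\frown\langle x\rangle)\unlhd a\unrhd\|(\alpha\frown\langle y\rangle)$; S2D1 $\mathrm{S2D}(\mathsf S)=\mathsf D$; S2D2 $\mathrm{S2D}(\mathsf D)=\mathsf D$; S2D3 $\mathrm{S2D}(\tau\circ x)=\tau\circ\mathrm{S2D}(x)$; S2D4 $\mathrm{S2D}(x\unlhd a\unrhd y)=\mathrm{S2D}(x)\unlhd a\unrhd\mathrm{S2D}(y)$;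 TSC1 $\mathsf S/_fH=\mathsf S$; TSC2 $\mathsf D/_fH=\mathsf D$; TSC3 $(\tau\circ x)/_fH=\tau\circ(x/_fH)$; TSC4 $(x\unlhd g.m\unrhd y)/_fH=(x/_fH)\unlhd g.m\unrhd(y/_fH)$ if $f\ne g$; TSC5 $(x\unlhd f.m\unrhd y)/_fH=\tau\circ(x/_f\partial_mH)$ if $H(\langle m\rangle)=\mathsf T$; TSC6 $(x\unlhd f.m\unrhd y)/_fH=\tau\circ(y/_f\partial_mH)$ if $H(\langle m\rangle)=\mathsf F$; TSC7 $(x\unlhd f.m\unrhd y)/_fH=\mathsf D$ if $H(\langle m\rangle)=\mathsf R$; R1 $\nu^f_s(t)=\nu^f_{s'}(t[s'/s]^f)$ if $s'\notin\mathrm{FN}^f(t)$; R2 $\nu^f_s(\mathsf S)=\mathsf S$; R3 $\nu^f_s(\mathsf D)=\mathsf D$; R4 $\nu^f_s(\tau\circ x)=\tau\circ\nu^f_s(x)$; R5 $\nu^f_s(x\unlhd g.m\unrhd y)=\nu^f_s(x)\unlhd g.m\unrhd\nu^f_s(y)$ if $f\ne g$; R6 $\nu^f_s(x\unlhd f.m\unrhd y)=\nu^f_s(x)\unlhd f.m\unrhd\nu^f_s(y)$ if $s\notin N(m)$; R7 $\|(\langle\nu^f_s(x)\rangle\frown\alpha)=\nu^f_s(\|(\langle x\rangle\frown\alpha))$ if $s\notin\mathrm{FN}^f(\alpha)$; R8 $\mathrm{S2D}(\nu^f_s(x))=\nu^f_s(\mathrm{S2D}(x))$; R9 $\nu^f_s(x)/_gH=\nu^f_s(x/_gH)$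 if $f\ne g$; R10 $\nu^f_s(x)/_fH=x/_fH$ if $H(\langle\mathrm{undef}(s)\rangle)\ne\mathsf F$; R11 $\nu^f_s(\nu^g_{s'}(x))=\nu^g_{s'}(\nu^f_s(x))$. Projective limit model. $\mathbb I$ is the domain of the initial model of $\mathrm{TC}$ (closed $\mathrm{TC}$ terms modulo derivable equality). Projections $\pi_n:\mathbb I\to\mathbb I$: $\pi_0(p)=\mathsf D$, $\pi_{n+1}(\mathsf S)=\mathsf S$, $\pi_{n+1}(\mathsf D)=\mathsf D$, $\pi_{n+1}(p\unlhd a\unrhd q)=\pi_n(p)\unlhd a\unrhd\pi_n(q)$, $\pi_{n+1}(\nu^f_s(p))=\nu^f_s(\pi_{n+1}(p))$. $\mathbb I_n=\{\pi_n(p):p\in\mathbb I\}$. $\mathbb P$ is the set of sequences $(p_n)_{n\in\mathbb N}$ with $p_n\in\mathbb I_n$ and $p_n=\pi_n(p_{n+1})$ for all $n$; $\mathsf D\in\mathbb P$ denotes $(\pi_n(\mathsf D))_n$. Projection on $\mathbb P$: $\pi_m((p_n)_n)=(p'_n)_n$ with $p'_n=p_n$ for $n<m$ and $p'_n=p_m$ for $n\ge m$. Metric on $\mathbb P$: $d(p,p')=2^{ -\min\{n\in\mathbb N:\pi_n(p)\neq\pi_n(p')\}}$ if $p\ne p'$, and $d(p,p)=0$. A unary operation $\phi$ on $\mathbb P$ is guarded if for all $p,p'\in\mathbb P$ and $n\in\mathbb N$: $\pi_n(p)=\pi_n(p')$ implies $\pi_{n+1}(\phi(p))=\pi_{n+1}(\phi(p'))$.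 $\phi^0(p)=p$, $\phi^{n+1}(p)=\phi(\phi^n(p))$. The projective limit model of $\mathrm{TC}+\mathrm{REC}$ has, on non-expansive functions $\phi:\mathbb P\to\mathbb P$, the operation $\mathrm{fix}(\phi)=(\pi_n(\phi^n(\mathsf D)))_n$ (the sequence whose $n$-th component is the $n$-th component of $\phi^n(\mathsf D)$) if $\phi$ is guarded, and $\mathrm{fix}(\phi)=\mathsf D$ otherwise. -}

module Defs where

open import Data.Nat using (ℕ; zero; suc; _<_; _⊓_)
open import Data.List using (List; []; _∷_; _++_; _∷ʳ_)
open import Data.List.Membership.Propositional using (_∈_; _∉_)
open import Data.Product using (Σ; ∃; _×_; _,_)
open import Data.Sum using (_⊎_)
open import Data.Rational using (ℚ; 0ℚ; 1ℚ; ½; _*_; _≤_)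
open import Relation.Nullary using (¬_)
open import Relation.Binary.PropositionalEquality using (_≡_; _≢_; refl)

data Val : Set where
  T F R : Val

-- A service H maps a non-empty finite sequence ⟨m⟩ ⁀ α of methods
-- (represented as  fun m α ) to a reply; R is persistent.
record Service (Method : Set) : Set where
  field
    fun    : Method → List Method → Val
    closed : ∀ m α m′ → fun m α ≡ R → fun m (α ++ m′ ∷ []) ≡ R
open Service public

reply : ∀ {Method} → Service Method → Method → Val
reply H m = fun H m []

∂ : ∀ {Method} → Method → Service Method → Service Method
fun    (∂ m H) m′ α      = fun H m (m′ ∷ α)
closed (∂ m H) m′ α m″ e = closed H m (m′ ∷ α) m″ e

record Setting : Set₁ where
  field
    Focus Method Spot : Set
    spots-infinite : ∀ (l : List Spot) → ∃ λ s → s ∉ l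
    Mmd     : Method → Set
    undef   : Spot → Method
    undef-md : ∀ s → Mmd (undef s)
    -- N(m): the finite set of spots occurring in m
    N       : Method → List Spot
    undef-N : ∀ s → s ∈ N (undef s)
    N-md    : ∀ m s → s ∈ N m → Mmd m
    -- rename s s′ m  is  m[s′/s]  (replace spot s by s′ in method m)
    rename  : Spot → Spot → Method → Method
    MDS     : Service Method → Set
    MDS-law : ∀ H → ¬ MDS H → ∀ m → Mmd m → reply H m ≡ R

module TC (σ : Setting) where
  open Setting σ

  Serv : Set
  Serv = Service Method

  data Act : Set where
    τ   : Act
    _∙_ : Focus → Method → Act

  data Term : Set where
    S D  : Term
    post : Term → Act → Term → Term          -- t₁ ⊴ a ⊵ t₂
    csi  : List Term → Term                  -- ∥(⟨t₁⟩⁀…⁀⟨tₖ⟩)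
    s2d  : Term → Term
    tsc  : Term → Focus → Serv → Term        -- t /_f H
    nu   : Focus → Spot → Term → Term

  τ∘_ : Term → Term
  τ∘ x = post x τ x

  -- Free spots w.r.t. a focus:  FN f s t  means  s ∈ FN^f(t)

  data FN (f : Focus) (s : Spot) : Term → Set where
    fn-act  : ∀ {x y m} → s ∈ N m → FN f s (post x (f ∙ m) y)
    fn-l    : ∀ {x y a} → FN f s x → FN f s (post x a y)
    fn-r    : ∀ {x y a} → FN f s y → FN f s (post x a y)
    fn-csi  : ∀ {t α} → t ∈ α → FN f s t → FN f s (csi α)
    fn-s2d  : ∀ {t} → FN f s t → FN f s (s2d t)
    fn-tsc  : ∀ {t g H} → FN f s t → FN f s (tsc t g H)
    fn-nu   : ∀ {t g s′} → ¬ (g ≡ f × s′ ≡ s) → FN f s t → FN f s (nu g s′ t)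

  FNs : Focus → Spot → List Term → Set
  FNs f s α = ∃ λ t → t ∈ α × FN f s t

  -- Capture-avoiding substitution  t[s′/s]^f  (as a relation; the result
  -- is determined up to the choice of fresh bound spots)

  data ActSub (f : Focus) (s s′ : Spot) : Act → Act → Set where
    as-τ    : ActSub f s s′ τ τ
    as-f    : ∀ {m} → ActSub f s s′ (f ∙ m) (f ∙ rename s s′ m)
    as-g    : ∀ {g m} → g ≢ f → ActSub f s s′ (g ∙ m) (g ∙ m)

  data Sub (f : Focus) : Spot → Spot → Term → Term → Set
  data SubL (f : Focus) (s s′ : Spot) : List Term → List Term → Set

  data Sub f where
    sb-S    : ∀ {s s′} → Sub f s s′ S S
    sb-D    : ∀ {s s′} → Sub f s s′ D D
    sb-post : ∀ {s s′ x x′ a a′ y y′} → Sub f s s′ x x′ → ActSub f s s′ a a′ →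
              Sub f s s′ y y′ → Sub f s s′ (post x a y) (post x′ a′ y′)
    sb-csi  : ∀ {s s′ α α′} → SubL f s s′ α α′ → Sub f s s′ (csi α) (csi α′)
    sb-s2d  : ∀ {s s′ x x′} → Sub f s s′ x x′ → Sub f s s′ (s2d x) (s2d x′)
    sb-tsc  : ∀ {s s′ x x′ g H} → Sub f s s′ x x′ →
              Sub f s s′ (tsc x g H) (tsc x′ g H)
    sb-nu-g : ∀ {s s′ g z x x′} → g ≢ f → Sub f s s′ x x′ →
              Sub f s s′ (nu g z x) (nu g z x′)
    sb-nu-s : ∀ {s s′ x} → Sub f s s′ (nu f s x) (nu f s x)
    sb-nu-z : ∀ {s s′ z x x′} → z ≢ s → z ≢ s′ → Sub f s s′ x x′ →
              Sub f s s′ (nu f z x) (nu f z x′)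
    sb-nu-vac : ∀ {s s′ x} → s′ ≢ s → ¬ FN f s x →
              Sub f s s′ (nu f s′ x) (nu f s′ x)
    sb-nu-ren : ∀ {s s′ z x w w′} → s′ ≢ s → ¬ FN f z x → z ≢ s → z ≢ s′ →
              Sub f s′ z x w → Sub f s s′ w w′ →
              Sub f s s′ (nu f s′ x) (nu f z w′)

  data SubL f s s′ where
    []  : SubL f s s′ [] []
    _∷_ : ∀ {x x′ α α′} → Sub f s s′ x x′ → SubL f s s′ α α′ →
          SubL f s s′ (x ∷ α) (x′ ∷ α′)

  infix 4 _≈_
  data _≈_ : Term → Term → Set where
    ≈-refl  : ∀ {x} → x ≈ x
    ≈-sym   : ∀ {x y} → x ≈ y → y ≈ x
    ≈-trans : ∀ {x y z} → x ≈ y → y ≈ z → x ≈ z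
    c-post  : ∀ {x x′ y y′ a} → x ≈ x′ → y ≈ y′ → post x a y ≈ post x′ a y′
    c-csi   : ∀ {α β x x′} → x ≈ x′ → csi (α ++ x ∷ β) ≈ csi (α ++ x′ ∷ β)
    c-s2d   : ∀ {x x′} → x ≈ x′ → s2d x ≈ s2d x′
    c-tsc   : ∀ {x x′ f H} → x ≈ x′ → tsc x f H ≈ tsc x′ f H
    c-tscH  : ∀ {x f H H′} → (∀ m α → fun H m α ≡ fun H′ m α) →
              tsc x f H ≈ tsc x f H′
    c-nu    : ∀ {x x′ f s} → x ≈ x′ → nu f s x ≈ nu f s x′
    T1   : ∀ {x y} → post x τ y ≈ τ∘ x
    CSI1 : csi [] ≈ S
    CSI2 : ∀ {α} → csi (S ∷ α) ≈ csi α
    CSI3 : ∀ {α} → csi (D ∷ α) ≈ s2d (csi α)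
    CSI4 : ∀ {x α} → csi ((τ∘ x) ∷ α) ≈ τ∘ csi (α ∷ʳ x)
    CSI5 : ∀ {x y f m α} → csi (post x (f ∙ m) y ∷ α) ≈
           post (csi (α ∷ʳ x)) (f ∙ m) (csi (α ∷ʳ y))
    S2D1 : s2d S ≈ D
    S2D2 : s2d D ≈ D
    S2D3 : ∀ {x} → s2d (τ∘ x) ≈ τ∘ s2d x
    S2D4 : ∀ {x y f m} → s2d (post x (f ∙ m) y) ≈ post (s2d x) (f ∙ m) (s2d y)
    TSC1 : ∀ {f H} → tsc S f H ≈ S
    TSC2 : ∀ {f H} → tsc D f H ≈ D
    TSC3 : ∀ {x f H} → tsc (τ∘ x) f H ≈ τ∘ tsc x f H
    TSC4 : ∀ {x y f g m H} → f ≢ g →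
           tsc (post x (g ∙ m) y) f H ≈ post (tsc x f H) (g ∙ m) (tsc y f H)
    TSC5 : ∀ {x y f m H} → reply H m ≡ T →
           tsc (post x (f ∙ m) y) f H ≈ τ∘ tsc x f (∂ m H)
    TSC6 : ∀ {x y f m H} → reply H m ≡ F →
           tsc (post x (f ∙ m) y) f H ≈ τ∘ tsc y f (∂ m H)
    TSC7 : ∀ {x y f m H} → reply H m ≡ R →
           tsc (post x (f ∙ m) y) f H ≈ D
    R1   : ∀ {f s s′ t t′} → ¬ FN f s′ t → Sub f s s′ t t′ →
           nu f s t ≈ nu f s′ t′
    R2   : ∀ {f s} → nu f s S ≈ S
    R3   : ∀ {f s} → nu f s D ≈ D
    R4   : ∀ {f s x} → nu f s (τ∘ x) ≈ τ∘ nu f s x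
    R5   : ∀ {f g s x y m} → f ≢ g →
           nu f s (post x (g ∙ m) y) ≈ post (nu f s x) (g ∙ m) (nu f s y)
    R6   : ∀ {f s x y m} → s ∉ N m →
           nu f s (post x (f ∙ m) y) ≈ post (nu f s x) (f ∙ m) (nu f s y)
    R7   : ∀ {f s x α} → ¬ FNs f s α →
           csi (nu f s x ∷ α) ≈ nu f s (csi (x ∷ α))
    R8   : ∀ {f s x} → s2d (nu f s x) ≈ nu f s (s2d x)
    R9   : ∀ {f g s x H} → f ≢ g → tsc (nu f s x) g H ≈ nu f s (tsc x g H)
    R10  : ∀ {f s x H} → reply H (undef s) ≢ F → tsc (nu f s x) f H ≈ tsc x f H
    R11  : ∀ {f g s s′ x} → nu f s (nu g s′ x) ≈ nu g s′ (nu f s x)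

  -- Projections on 𝕀, via the representatives on which they are defined

  data BT : Set where
    bS bD : BT
    bpost : BT → Act → BT → BT
    bnu   : Focus → Spot → BT → BT

  ⌜_⌝ : BT → Term
  ⌜ bS ⌝ = S
  ⌜ bD ⌝ = D
  ⌜ bpost p a q ⌝ = post ⌜ p ⌝ a ⌜ q ⌝
  ⌜ bnu f s p ⌝ = nu f s ⌜ p ⌝

  πb : ℕ → BT → BT
  πb zero _ = bD
  πb (suc n) bS = bS
  πb (suc n) bD = bD
  πb (suc n) (bpost p a q) = bpost (πb n p) a (πb n q)
  πb (suc n) (bnu f s p) = bnu f s (πb (suc n) p)

  -- Proj n p q :  q = π_n(p)  in 𝕀
  Proj : ℕ → Term → Term → Set
  Proj n p q = Σ BT λ b → (p ≈ ⌜ b ⌝) × (q ≈ ⌜ πb n b ⌝)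

  𝕀_ : ℕ → Term → Set
  (𝕀 n) q = ∃ λ p → Proj n p q

  Seq : Set
  Seq = ℕ → Term

  record ℙ : Set where
    field
      seq : Seq
      inI : ∀ n → (𝕀 n) (seq n)
      coh : ∀ n → Proj n (seq (suc n)) (seq n)
  open ℙ public

  infix 4 _≈S_
  _≈S_ : Seq → Seq → Set
  p ≈S q = ∀ k → p k ≈ q k

  πb-D : ∀ n → ⌜ πb n bD ⌝ ≡ D
  πb-D zero = refl
  πb-D (suc n) = refl

  private
    projD : ∀ n → Proj n D D
    projD n = bD , ≈-refl , eqD n
      where
        eqD : ∀ n → D ≈ ⌜ πb n bD ⌝
        eqD zero = ≈-refl
        eqD (suc n) = ≈-refl

  Dℙ : ℙ
  seq Dℙ _ = D
  inI Dℙ n = D , projD n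
  coh Dℙ n = projD n

  π[_] : ℕ → Seq → Seq
  π[ m ] p k = p (k ⊓ m)

  half^ : ℕ → ℚ
  half^ zero = 1ℚ
  half^ (suc n) = ½ * half^ n

  Dist : Seq → Seq → ℚ → Set
  Dist p p′ e =
    (p ≈S p′ × e ≡ 0ℚ)
    ⊎ Σ ℕ λ n → ¬ (π[ n ] p ≈S π[ n ] p′)
               × (∀ m → m < n → π[ m ] p ≈S π[ m ] p′)
               × e ≡ half^ n

  Respects : (ℙ → ℙ) → Set
  Respects φ = ∀ p q → seq p ≈S seq q → seq (φ p) ≈S seq (φ q)

  NonExpansive : (ℙ → ℙ) → Set
  NonExpansive φ = ∀ p q e e′ →
    Dist (seq (φ p)) (seq (φ q)) e → Dist (seq p) (seq q) e′ → e ≤ e′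

  Guarded : (ℙ → ℙ) → Set
  Guarded φ = ∀ p p′ n → π[ n ] (seq p) ≈S π[ n ] (seq p′) →
    π[ suc n ] (seq (φ p)) ≈S π[ suc n ] (seq (φ p′))

  iter : (ℙ → ℙ) → ℕ → ℙ → ℙ
  iter φ zero p = p
  iter φ (suc n) p = φ (iter φ n p)

  fixG : (ℙ → ℙ) → Seq
  fixG φ n = seq (iter φ n Dℙ) n

module Submission where

-- Write p ≈[ m ] q when the sequences p and q agree in components 0,…,m.
-- For guarded φ the approximants aₘ = φᵐ(D) satisfy aₘ ≈[ m ] aₘ₊₁, hence
-- aₘ ≈[ m ] fix φ; consequently fix φ is itself an element of ℙ, and the
-- central lemma follows: whenever x ≈[ m ] fix φ, also φ(x) ≈[ m+1 ] fix φ.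
--
-- Apply this to the single point p = fix φ.  Then φ(p) agrees with fix φ
-- everywhere, and whenever fix φ ≈[ m ] fix ψ, ψ(p) agrees with fix ψ up to
-- m+1.  Hence fix φ and fix ψ first differ exactly where φ(p) and ψ(p)
-- first differ: every value e of d(fix φ, fix ψ) is also a value of
-- d(φ(p), ψ(p)), and so lies below every upper bound of δ(φ, ψ).

open import Defs
open import Data.Rational using (ℚ; _≤_)
open import Data.Nat using (ℕ; zero; suc; z≤n; _⊓_) renaming (_≤_ to _≤ℕ_; _<_ to _<ℕ_)
open import Data.Nat.Properties using (≤-refl; ≤-trans; ≤-pred; n≤1+n; m≤n⇒m⊓n≡m; m⊓n≤n; m≤n⇒m<n∨m≡n)
open import Data.Product using (_,_)
open import Data.Sum using (inj₁; inj₂)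
open import Data.Empty using (⊥-elim)
open import Function using (_∘_)
open import Relation.Binary.PropositionalEquality using (refl; subst)

module LimitModel (σ : Setting) where
  open TC σ

  -- Agreement of two sequences in the components 0, …, j.  A record, so
  -- that the two sequences can be inferred from an agreement proof.
  record _≈[_]_ (x : Seq) (j : ℕ) (y : Seq) : Set where
    constructor agree
    field at : ∀ k → k ≤ℕ j → x k ≈ y k
  open _≈[_]_

  ≈[]-sym : ∀ {x y j} → x ≈[ j ] y → y ≈[ j ] x
  ≈[]-sym h = agree λ k k≤j → ≈-sym (at h k k≤j)

  ≈[]-trans : ∀ {x y z j} → x ≈[ j ] y → y ≈[ j ] z → x ≈[ j ] z
  ≈[]-trans h h′ = agree λ k k≤j → ≈-trans (at h k k≤j) (at h′ k k≤j)

  ≈[]-mono : ∀ {x y i j} → i ≤ℕ j → x ≈[ j ] y → x ≈[ i ] y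
  ≈[]-mono i≤j h = agree λ k k≤i → at h k (≤-trans k≤i i≤j)

  ≈[]-extend : ∀ {x y m} → x ≈[ m ] y → x (suc m) ≈ y (suc m) → x ≈[ suc m ] y
  ≈[]-extend {x} {y} {m} h e = agree extended
    where
    extended : ∀ k → k ≤ℕ suc m → x k ≈ y k
    extended k k≤sm with m≤n⇒m<n∨m≡n k≤sm
    ... | inj₁ k<sm = at h k (≤-pred k<sm)
    ... | inj₂ refl = e

  ≈[]-fromπ : ∀ {x y j} → π[ j ] x ≈S π[ j ] y → x ≈[ j ] y
  ≈[]-fromπ {x} {y} {j} h = agree λ k k≤j →
    subst (λ i → x i ≈ y i) (m≤n⇒m⊓n≡m k≤j) (h k)

  ≈[]-toπ : ∀ {x y j} → x ≈[ j ] y → π[ j ] x ≈S π[ j ] y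
  ≈[]-toπ {j = j} h k = at h (k ⊓ j) (m⊓n≤n k j)

  -- The 0-th component of every element of ℙ is D (it lies in 𝕀₀), so any
  -- two elements of ℙ agree up to 0.
  ≈[]-zero : ∀ (p q : ℙ) → seq p ≈[ 0 ] seq q
  ≈[]-zero p q = agree λ { zero z≤n → ≈-trans (component0 p) (≈-sym (component0 q)) }
    where
    component0 : ∀ p → seq p 0 ≈ D
    component0 p with inI p 0
    ... | _ , _ , _ , q≈D = q≈D

  module Fixpoint (φ : ℙ → ℙ) (g : Guarded φ) where

    guarded : ∀ {n} (x y : ℙ) → seq x ≈[ n ] seq y → seq (φ x) ≈[ suc n ] seq (φ y)
    guarded {n} x y h = ≈[]-fromπ (g x y n (≈[]-toπ h))

    approx : ℕ → ℙ
    approx m = iter φ m Dℙ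

    approx-step : ∀ m → seq (approx m) ≈[ m ] seq (approx (suc m))
    approx-step zero = ≈[]-zero (approx 0) (approx 1)
    approx-step (suc m) = guarded (approx m) (approx (suc m)) (approx-step m)

    approx-fix : ∀ m → seq (approx m) ≈[ m ] fixG φ
    approx-fix zero = agree λ { zero z≤n → ≈-refl }
    approx-fix (suc m) =
      ≈[]-extend (≈[]-trans (≈[]-sym (approx-step m)) (approx-fix m)) ≈-refl

    -- fix φ is an element of ℙ: its components are those of approximants,
    -- and coherence is inherited from approx (m+1) thanks to approx-fix.
    fixℙ : ℙ
    seq fixℙ = fixG φ
    inI fixℙ n = inI (approx n) n
    coh fixℙ n with coh (approx (suc n)) n
    ... | b , p≈b , q≈πb =
      b , p≈b , ≈-trans (≈-sym (at (approx-fix (suc n)) n (n≤1+n n))) q≈πb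

    improve : ∀ {m} (x : ℙ) → seq x ≈[ m ] fixG φ → seq (φ x) ≈[ suc m ] fixG φ
    improve {m} x h =
      ≈[]-trans (guarded x (approx m) (≈[]-trans h (≈[]-sym (approx-fix m))))
                (approx-fix (suc m))

  fix-distance-attained : ∀ φ ψ (gφ : Guarded φ) (gψ : Guarded ψ) →
    let p = Fixpoint.fixℙ φ gφ in
    ∀ e → Dist (fixG φ) (fixG ψ) e → Dist (seq (φ p)) (seq (ψ p)) e
  fix-distance-attained φ ψ gφ gψ = attained
    where
    open Fixpoint φ gφ using (fixℙ; improve)
    open Fixpoint ψ gψ using () renaming (improve to improveψ; fixℙ to fixℙψ)

    trackφ : ∀ m → seq (φ fixℙ) ≈[ suc m ] fixG φ
    trackφ m = improve fixℙ (agree λ _ _ → ≈-refl)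

    trackψ : ∀ {m} → fixG φ ≈[ m ] fixG ψ → seq (ψ fixℙ) ≈[ suc m ] fixG ψ
    trackψ = improveψ fixℙ

    agreement-preserved : ∀ {m} → fixG φ ≈[ m ] fixG ψ → seq (φ fixℙ) ≈[ m ] seq (ψ fixℙ)
    agreement-preserved {m} h = ≈[]-trans (≈[]-mono (n≤1+n m) (trackφ m))
      (≈[]-trans h (≈[]-sym (≈[]-mono (n≤1+n m) (trackψ h))))

    agreement-reflected : ∀ {m} → fixG φ ≈[ m ] fixG ψ →
      seq (φ fixℙ) ≈[ suc m ] seq (ψ fixℙ) → fixG φ ≈[ suc m ] fixG ψ
    agreement-reflected {m} h same =
      ≈[]-trans (≈[]-sym (trackφ m)) (≈[]-trans same (trackψ h))

    attained : ∀ e → Dist (fixG φ) (fixG ψ) e → Dist (seq (φ fixℙ)) (seq (ψ fixℙ)) e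
    attained e (inj₁ (same , e≡0)) = inj₁ (images-equal , e≡0)
      where
      images-equal : seq (φ fixℙ) ≈S seq (ψ fixℙ)
      images-equal k = at (agreement-preserved (agree λ i _ → same i)) k ≤-refl
    attained e (inj₂ (zero , differ , _ , _)) =
      ⊥-elim (differ (≈[]-toπ (≈[]-zero fixℙ fixℙψ)))
    attained e (inj₂ (suc m , differ , below , e≡)) =
      inj₂ (suc m , differ ∘ ≈[]-toπ ∘ agreement-reflected fixes-agree ∘ ≈[]-fromπ ,
             images-below , e≡)
      where
      fixes-agree : fixG φ ≈[ m ] fixG ψ
      fixes-agree = ≈[]-fromπ (below m ≤-refl)

      images-below : ∀ j → j <ℕ suc m →
                     π[ j ] (seq (φ fixℙ)) ≈S π[ j ] (seq (ψ fixℙ))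
      images-below j j<sm = ≈[]-toπ (≈[]-mono (≤-pred j<sm) (agreement-preserved fixes-agree))

theorem8 : (σ : Setting) → let open TC σ in
    (φ ψ : ℙ → ℙ) →
    Respects φ → Respects ψ →
    NonExpansive φ → NonExpansive ψ →
    Guarded φ → Guarded ψ →
    -- d(fix φ, fix ψ) ≤ sup{d(φ p, ψ p)}: below every upper bound r
    (r : ℚ) → (∀ p e → Dist (seq (φ p)) (seq (ψ p)) e → e ≤ r) →
    ∀ e → Dist (fixG φ) (fixG ψ) e → e ≤ r
theorem8 σ φ ψ _ _ _ _ gφ gψ r δ≤r e dist =
  δ≤r (Fixpoint.fixℙ φ gφ) e (fix-distance-attained φ ψ gφ gψ e dist)
  where open LimitModel σ
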